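{- Let $\mathfrak S$ be an algebraic signature and $g:X\to Y$ a morphism of algebraic $\mathfrak S$-structures. (1) $g$ is a monomorphism in $\mathrm{Alg}(\mathfrak S)$ if and only if it is injective (each $g_s$ injective). (2) Let $g=g'\circ h$ with $h:X\to X'$, $g':X'\to Y$ be the relative totalization of $X$ over $Y$. Then $g$ is an epimorphism in $\mathrm{Alg}(\mathfrak S)$ if and only if $g'$ is surjective (each $g'_s$ surjective).
   Context: An algebraic signature $\mathfrak S=(S,P\sqcup F)$ has sorts $S$, predicate symbols $p:s_1\times\dots\times s_n$ and function symbols $f:s_1\times\dots\times s_n\to s$. An algebraic structure has carriers $X_s$, relations $p_X$ and partial functions $f_X:X_{s_1}\times\dots\times X_{s_n}\rightharpoonup X_s$; morphisms are sortwise functions preserving relations and graphs of partial functions; this gives the complete and cocomplete category $\mathrm{Alg}(\mathfrak S)$. For $f:s_1\times\dots\times s_n\to s$ in $F$, $[f\downarrow]:A_f\to B_f$ is the inclusion of the structure with exactly $n$ distinct elements $a_1,\dots,a_n$ ($a_i$ of sort $s_i$) and no relations or function values into the structure with one additional element $b$ of sort $s$ and $f(a_1,\dots,a_n)=b$ as the only function value; $\mathrm{Tot}=\{[f\downarrow]\mid f\in F\}$. Relative $\mathrm{Tot}$-cell complexes form the least class of morphisms of $\mathrm{Alg}(\mathfrak S)$ containing $\mathrm{Tot}$ and closed under set-indexed coproducts, pushouts along arbitrary maps and compositions of countable sequences. $X'$ is total over $Y$ w.r.t. $g':X'\to Y$ if for all $f\in F$ and $x_i\in X'$, definedness of $f_Y(g'(x_1),\dots,g'(x_n))$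 implies definedness of $f_{X'}(x_1,\dots,x_n)$. The relative totalization of $X$ over $Y$ (for $g$) is the factorization $g=g'\circ h$, unique up to unique isomorphism, in which $h:X\to X'$ is a relative $\mathrm{Tot}$-cell complex and $X'$ is total over $Y$ with respect to $g'$. -}

module Defs where

open import Level using (0ℓ)
open import Data.Nat using (ℕ; suc)
open import Data.Fin using (Fin)
open import Data.Product using (Σ; _×_; _,_; proj₁; proj₂)
open import Data.Sum using (_⊎_; inj₁; inj₂)
open import Data.Unit using (⊤; tt)
open import Data.Empty using (⊥; ⊥-elim)
open import Relation.Binary.Bundles using (Setoid)
open import Relation.Binary.PropositionalEquality as ≡ using (_≡_)

record Signature : Set₁ where
  field
    Sort  : Set
    Pred  : Set
    Fun   : Set
    parity : Pred → ℕ
    psort  : (p : Pred) → Fin (parity p) → Sort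
    farity : Fun → ℕ
    fsort  : (f : Fun) → Fin (farity f) → Sort
    fres   : Fun → Sort

module Alg (𝔖 : Signature) where
  open Signature 𝔖 public

  Tup : (Sort → Setoid 0ℓ 0ℓ) → (n : ℕ) → (Fin n → Sort) → Set
  Tup X n ss = (i : Fin n) → Setoid.Carrier (X (ss i))

  _⊢_≈ₜ_ : (X : Sort → Setoid 0ℓ 0ℓ) {n : ℕ} {ss : Fin n → Sort} →
           Tup X n ss → Tup X n ss → Set
  X ⊢ xs ≈ₜ ys = ∀ i → Setoid._≈_ (X _) (xs i) (ys i)

  -- An algebraic 𝔖-structure: carriers Xₛ (sets, rendered as setoids),
  -- relations p_X, and partial functions f_X given by their graphs
  -- (functional relations).
  record Structure : Set₁ where
    field
      car   : Sort → Setoid 0ℓ 0ℓ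
      rel   : (p : Pred) → Tup car (parity p) (psort p) → Set
      rel-resp : ∀ p {xs ys} → car ⊢ xs ≈ₜ ys → rel p xs → rel p ys
      graph : (f : Fun) → Tup car (farity f) (fsort f) →
              Setoid.Carrier (car (fres f)) → Set
      graph-resp : ∀ f {xs xs' y y'} → car ⊢ xs ≈ₜ xs' →
                   Setoid._≈_ (car (fres f)) y y' → graph f xs y → graph f xs' y'
      graph-functional : ∀ f {xs y y'} → graph f xs y → graph f xs y' →
                         Setoid._≈_ (car (fres f)) y y'

  open Structure public

  ∣_∣ : Structure → Sort → Set
  ∣ X ∣ s = Setoid.Carrier (car X s)

  _⊢_≈_ : (X : Structure) {s : Sort} → ∣ X ∣ s → ∣ X ∣ s → Set
  X ⊢ x ≈ y = Setoid._≈_ (car X _) x y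

  record Hom (X Y : Structure) : Set where
    field
      fun  : ∀ s → ∣ X ∣ s → ∣ Y ∣ s
      cong : ∀ s {x y} → X ⊢ x ≈ y → Y ⊢ fun s x ≈ fun s y
      pres-rel : ∀ p xs → rel X p xs → rel Y p (λ i → fun (psort p i) (xs i))
      pres-graph : ∀ f xs y → graph X f xs y →
                   graph Y f (λ i → fun (fsort f i) (xs i)) (fun (fres f) y)

  open Hom public

  _∘ₘ_ : {X Y Z : Structure} → Hom Y Z → Hom X Y → Hom X Z
  fun (g ∘ₘ h) s x = fun g s (fun h s x)
  cong (g ∘ₘ h) s e = cong g s (cong h s e)
  pres-rel (g ∘ₘ h) p xs r = pres-rel g p _ (pres-rel h p xs r)
  pres-graph (g ∘ₘ h) f xs y r = pres-graph g f _ _ (pres-graph h f xs y r)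

  _≈ₘ_ : {X Y : Structure} → Hom X Y → Hom X Y → Set
  _≈ₘ_ {Y = Y} g h = ∀ s x → Y ⊢ fun g s x ≈ fun h s x

  ∃!ₘ : {X Y : Structure} → (Hom X Y → Set) → Set
  ∃!ₘ {X} {Y} P = Σ (Hom X Y) (λ u → P u × (∀ v → P v → v ≈ₘ u))

  Mono : {X Y : Structure} → Hom X Y → Set₁
  Mono {X} {Y} g = ∀ (Z : Structure) (u v : Hom Z X) →
                   (g ∘ₘ u) ≈ₘ (g ∘ₘ v) → u ≈ₘ v

  Epi : {X Y : Structure} → Hom X Y → Set₁
  Epi {X} {Y} g = ∀ (Z : Structure) (u v : Hom Y Z) →
                  (u ∘ₘ g) ≈ₘ (v ∘ₘ g) → u ≈ₘ v

  Injective : {X Y : Structure} → Hom X Y → Set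
  Injective {X} {Y} g = ∀ s (x y : ∣ X ∣ s) →
                        Y ⊢ fun g s x ≈ fun g s y → X ⊢ x ≈ y

  Surjective : {X Y : Structure} → Hom X Y → Set
  Surjective {X} {Y} g = ∀ s (y : ∣ Y ∣ s) → Σ (∣ X ∣ s) (λ x → Y ⊢ fun g s x ≈ y)

  module _ (f : Fun) where
    -- A_f: exactly the n distinct elements a₁,…,aₙ (aᵢ of sort sᵢ)
    Acar : Sort → Set
    Acar s = Σ (Fin (farity f)) (λ i → fsort f i ≡ s)

    A≈ : ∀ {s} → Acar s → Acar s → Set
    A≈ a a' = proj₁ a ≡ proj₁ a'

    Aset : Sort → Setoid 0ℓ 0ℓ
    Aset s = record
      { Carrier = Acar s ; _≈_ = A≈
      ; isEquivalence = record { refl = ≡.refl ; sym = ≡.sym ; trans = ≡.trans } }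

    -- B_f: A_f plus one element b of sort (fres f)
    Bcar : Sort → Set
    Bcar s = Acar s ⊎ (fres f ≡ s)

    B≈ : ∀ {s} → Bcar s → Bcar s → Set
    B≈ (inj₁ a) (inj₁ a') = A≈ a a'
    B≈ (inj₁ _) (inj₂ _)  = ⊥
    B≈ (inj₂ _) (inj₁ _)  = ⊥
    B≈ (inj₂ _) (inj₂ _)  = ⊤

    B-refl : ∀ {s} {x : Bcar s} → B≈ x x
    B-refl {x = inj₁ _} = ≡.refl
    B-refl {x = inj₂ _} = tt

    B-sym : ∀ {s} {x y : Bcar s} → B≈ x y → B≈ y x
    B-sym {x = inj₁ _} {inj₁ _} e = ≡.sym e
    B-sym {x = inj₂ _} {inj₂ _} e = tt

    B-trans : ∀ {s} {x y z : Bcar s} → B≈ x y → B≈ y z → B≈ x z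
    B-trans {x = inj₁ _} {inj₁ _} {inj₁ _} e e' = ≡.trans e e'
    B-trans {x = inj₂ _} {inj₂ _} {inj₂ _} e e' = tt

    Bset : Sort → Setoid 0ℓ 0ℓ
    Bset s = record
      { Carrier = Bcar s ; _≈_ = B≈
      ; isEquivalence = record { refl = B-refl ; sym = B-sym ; trans = B-trans } }

    b : Bcar (fres f)
    b = inj₂ ≡.refl

    a : (i : Fin (farity f)) → Bcar (fsort f i)
    a i = inj₁ (i , ≡.refl)

    data BGraph : (f' : Fun) → Tup Bset (farity f') (fsort f') →
                  Bcar (fres f') → Set where
      f-ab : (xs : Tup Bset (farity f) (fsort f)) → (∀ i → B≈ (xs i) (a i)) →
             (y : Bcar (fres f)) → B≈ y b → BGraph f xs y

    BGraph-resp : ∀ f' {xs xs' y y'} → Bset ⊢ xs ≈ₜ xs' → B≈ y y' →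
                  BGraph f' xs y → BGraph f' xs' y'
    BGraph-resp _ e e' (f-ab xs p y q) =
      f-ab _ (λ i → B-trans (B-sym (e i)) (p i)) _ (B-trans (B-sym e') q)

    BGraph-fun : ∀ f' {xs y y'} → BGraph f' xs y → BGraph f' xs y' → B≈ y y'
    BGraph-fun _ (f-ab _ _ _ q) (f-ab _ _ _ q') = B-trans q (B-sym q')

    A[_] : Structure
    A[_] = record
      { car = Aset
      ; rel = λ _ _ → ⊥
      ; rel-resp = λ _ _ ()
      ; graph = λ _ _ _ → ⊥
      ; graph-resp = λ _ _ _ ()
      ; graph-functional = λ _ () }

    B[_] : Structure
    B[_] = record
      { car = Bset
      ; rel = λ _ _ → ⊥
      ; rel-resp = λ _ _ ()
      ; graph = BGraph
      ; graph-resp = BGraph-resp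
      ; graph-functional = BGraph-fun }

    [_↓] : Hom A[_] B[_]
    [_↓] = record
      { fun = λ _ x → inj₁ x
      ; cong = λ _ e → e
      ; pres-rel = λ _ _ ()
      ; pres-graph = λ _ _ _ () }

  IsCoproduct : {I : Set} (A : I → Structure) (C : Structure) →
                ((i : I) → Hom (A i) C) → Set₁
  IsCoproduct {I} A C ι =
    ∀ (Z : Structure) (c : (i : I) → Hom (A i) Z) →
      ∃!ₘ (λ u → ∀ i → (u ∘ₘ ι i) ≈ₘ c i)

  -- the square  h ∘ m = m' ∘ k  is a pushout (of k along m)
  IsPushout : {A B C D : Structure} → Hom A B → Hom A C → Hom C D → Hom B D → Set₁
  IsPushout {A} {B} {C} {D} k m h m' =
    ((h ∘ₘ m) ≈ₘ (m' ∘ₘ k)) ×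
    (∀ (Z : Structure) (p : Hom C Z) (q : Hom B Z) → (p ∘ₘ m) ≈ₘ (q ∘ₘ k) →
       ∃!ₘ (λ u → ((u ∘ₘ h) ≈ₘ p) × ((u ∘ₘ m') ≈ₘ q)))

  IsSeqColimit : (X : ℕ → Structure) → (∀ n → Hom (X n) (X (suc n))) →
                 (L : Structure) → (∀ n → Hom (X n) L) → Set₁
  IsSeqColimit X k L c =
    (∀ n → (c (suc n) ∘ₘ k n) ≈ₘ c n) ×
    (∀ (Z : Structure) (z : ∀ n → Hom (X n) Z) →
       (∀ n → (z (suc n) ∘ₘ k n) ≈ₘ z n) →
       ∃!ₘ (λ u → ∀ n → (u ∘ₘ c n) ≈ₘ z n))

  data IsCell : {X Y : Structure} → Hom X Y → Set₁ where
    tot : (f : Fun) → IsCell [ f ↓]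
    coprod : {I : Set} {A B : I → Structure} {C D : Structure}
             (k : (i : I) → Hom (A i) (B i)) → (∀ i → IsCell (k i)) →
             (ι : (i : I) → Hom (A i) C) → IsCoproduct A C ι →
             (κ : (i : I) → Hom (B i) D) → IsCoproduct B D κ →
             (h : Hom C D) → (∀ i → (h ∘ₘ ι i) ≈ₘ (κ i ∘ₘ k i)) →
             IsCell h
    pushout : {A B C D : Structure}
              (k : Hom A B) → IsCell k →
              (m : Hom A C) (h : Hom C D) (m' : Hom B D) → IsPushout k m h m' →
              IsCell h
    seqcomp : (X : ℕ → Structure) (k : ∀ n → Hom (X n) (X (suc n))) →
              (∀ n → IsCell (k n)) →
              (L : Structure) (c : ∀ n → Hom (X n) L) → IsSeqColimit X k L c →
              (h : Hom (X 0) L) → h ≈ₘ c 0 →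
              IsCell h

  TotalOver : {X' Y : Structure} → Hom X' Y → Set
  TotalOver {X'} {Y} g' =
    ∀ (f : Fun) (xs : Tup (car X') (farity f) (fsort f)) →
      Σ (∣ Y ∣ (fres f)) (graph Y f (λ i → fun g' (fsort f i) (xs i))) →
      Σ (∣ X' ∣ (fres f)) (graph X' f xs)

  IsRelativeTotalization : {X X' Y : Structure} →
    Hom X Y → Hom X X' → Hom X' Y → Set₁
  IsRelativeTotalization g h g' = ((g' ∘ₘ h) ≈ₘ g) × IsCell h × TotalOver g'

-- Monos are injective: test them against the one-element structure of each sort.
-- Every [f↓] is an epimorphism, since its new element is a function value of the
-- old ones, and epimorphisms are stable under the coproducts, pushouts and
-- sequential colimits generating relative Tot-cell complexes; hence g = g' ∘ h is
-- epi as soon as g' is surjective. Conversely, totality of X' over Y makes the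
-- image of g' closed under the partial operations of Y. Gluing two copies of Y
-- along a closed subset yields two morphisms out of Y that agree exactly on that
-- subset; if g is epi they coincide, so the image of g', which contains that of g,
-- is everything.
module Submission where

open import Defs
open import Level using (0ℓ)
open import Data.Bool using (Bool; true; false; _≟_)
open import Data.Empty using (⊥; ⊥-elim)
open import Data.Nat using (zero; suc)
open import Data.Product using (Σ; _×_; _,_; proj₁; proj₂)
open import Data.Sum using (_⊎_; inj₁; inj₂; [_,_])
open import Function using (id; _∘_)
open import Function.Bundles using (_⇔_; mk⇔)
open import Relation.Binary.Bundles using (Setoid)
open import Relation.Binary.PropositionalEquality as ≡ using (_≡_)
import Relation.Binary.Reasoning.Setoid as SetoidReasoning
open import Relation.Nullary using (yes; no)

module Properties (𝔖 : Signature) where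
  open Alg 𝔖

  module _ {X Y : Structure} where
    ≈ₘ-refl : {u : Hom X Y} → u ≈ₘ u
    ≈ₘ-refl s x = Setoid.refl (car Y s)

    ≈ₘ-sym : {u v : Hom X Y} → u ≈ₘ v → v ≈ₘ u
    ≈ₘ-sym e s x = Setoid.sym (car Y s) (e s x)

    ≈ₘ-trans : {u v w : Hom X Y} → u ≈ₘ v → v ≈ₘ w → u ≈ₘ w
    ≈ₘ-trans e e' s x = Setoid.trans (car Y s) (e s x) (e' s x)

    ∃!ₘ-unique : {P : Hom X Y → Set} → ∃!ₘ P → (u v : Hom X Y) → P u → P v → u ≈ₘ v
    ∃!ₘ-unique (w , _ , unique) u v pu pv =
      ≈ₘ-trans {u = u} {w} {v} (unique u pu) (≈ₘ-sym {u = v} {w} (unique v pv))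

  Hom-setoid : Structure → Structure → Setoid 0ℓ 0ℓ
  Hom-setoid X Y = record
    { Carrier = Hom X Y
    ; _≈_ = _≈ₘ_
    ; isEquivalence = record
      { refl = λ {u} → ≈ₘ-refl {u = u}
      ; sym = λ {u} {v} → ≈ₘ-sym {u = u} {v}
      ; trans = λ {u} {v} {w} → ≈ₘ-trans {u = u} {v} {w} } }

  idₘ : {X : Structure} → Hom X X
  idₘ = record
    { fun = λ _ x → x
    ; cong = λ _ e → e
    ; pres-rel = λ _ _ r → r
    ; pres-graph = λ _ _ _ g → g }

  module _ {X Y Z : Structure} where
    ∘ₘ-congˡ : (u : Hom Y Z) {w w' : Hom X Y} → w ≈ₘ w' → (u ∘ₘ w) ≈ₘ (u ∘ₘ w')
    ∘ₘ-congˡ u e s x = cong u s (e s x)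

    ∘ₘ-congʳ : (w : Hom X Y) {u v : Hom Y Z} → u ≈ₘ v → (u ∘ₘ w) ≈ₘ (v ∘ₘ w)
    ∘ₘ-congʳ w e s x = e s (fun w s x)

    agreement-resp-≈ₘ : (u v : Hom Y Z) {h h' : Hom X Y} →
                        h ≈ₘ h' → (u ∘ₘ h) ≈ₘ (v ∘ₘ h) → (u ∘ₘ h') ≈ₘ (v ∘ₘ h')
    agreement-resp-≈ₘ u v {h} {h'} h≈h' e = begin
      u ∘ₘ h' ≈⟨ ∘ₘ-congˡ u {h} {h'} h≈h' ⟨
      u ∘ₘ h  ≈⟨ e ⟩
      v ∘ₘ h  ≈⟨ ∘ₘ-congˡ v {h} {h'} h≈h' ⟩
      v ∘ₘ h' ∎
      where open SetoidReasoning (Hom-setoid X Z)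

  Point : Sort → Structure
  Point s = record
    { car = λ t → ≡.setoid (s ≡ t)
    ; rel = λ _ _ → ⊥
    ; rel-resp = λ _ _ ()
    ; graph = λ _ _ _ → ⊥
    ; graph-resp = λ _ _ _ ()
    ; graph-functional = λ _ () }

  point : {X : Structure} {s : Sort} → ∣ X ∣ s → Hom (Point s) X
  point {X} x = record
    { fun = λ t p → ≡.subst ∣ X ∣ p x
    ; cong = λ t p≡q → Setoid.reflexive (car X t) (≡.cong (λ p → ≡.subst ∣ X ∣ p x) p≡q)
    ; pres-rel = λ _ _ ()
    ; pres-graph = λ _ _ _ () }

  mono⇒injective : {X Y : Structure} (g : Hom X Y) → Mono g → Injective g
  mono⇒injective g mono s x y gx≈gy =
    mono (Point s) (point x) (point y) (λ { _ ≡.refl → gx≈gy }) s ≡.refl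

  injective⇒mono : {X Y : Structure} (g : Hom X Y) → Injective g → Mono g
  injective⇒mono g inj Z u v e s z = inj s _ _ (e s z)

  Epi-resp-≈ₘ : {X Y : Structure} {g g' : Hom X Y} → g ≈ₘ g' → Epi g → Epi g'
  Epi-resp-≈ₘ {g = g} {g'} g≈g' epi Z u v e =
    epi Z u v (agreement-resp-≈ₘ u v {g'} {g} (≈ₘ-sym {u = g} {g'} g≈g') e)

  ∘ₘ-epi : {X Y Z : Structure} {g : Hom Y Z} {h : Hom X Y} → Epi g → Epi h → Epi (g ∘ₘ h)
  ∘ₘ-epi {g = g} epi-g epi-h W u v e = epi-g W u v (epi-h W (u ∘ₘ g) (v ∘ₘ g) e)

  surjective⇒epi : {X Y : Structure} (g : Hom X Y) → Surjective g → Epi g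
  surjective⇒epi {X} g surj Z u v e s y = begin
    fun u s y                ≈⟨ cong u s (proj₂ (surj s y)) ⟨
    fun u s (fun g s x)      ≈⟨ e s x ⟩
    fun v s (fun g s x)      ≈⟨ cong v s (proj₂ (surj s y)) ⟩
    fun v s y                ∎
    where
      x : ∣ X ∣ s
      x = proj₁ (surj s y)
      open SetoidReasoning (car Z s)

  agreement-across-square : {A B C D Z : Structure}
    (k : Hom A B) (m : Hom A C) (h : Hom C D) (m' : Hom B D) → Epi k →
    (h ∘ₘ m) ≈ₘ (m' ∘ₘ k) → (u v : Hom D Z) →
    (u ∘ₘ h) ≈ₘ (v ∘ₘ h) → (u ∘ₘ m') ≈ₘ (v ∘ₘ m')
  agreement-across-square k m h m' epi square u v e =
    epi _ (u ∘ₘ m') (v ∘ₘ m')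
      (agreement-resp-≈ₘ u v {h ∘ₘ m} {m' ∘ₘ k} square (∘ₘ-congʳ m {u ∘ₘ h} {v ∘ₘ h} e))

  Tot-epi : (f : Fun) → Epi [ f ↓]
  Tot-epi f Z u v e s (inj₁ x) = e s x
  Tot-epi f Z u v e _ (inj₂ ≡.refl) =
    graph-functional Z f
      (graph-resp Z f (λ i → e _ (i , ≡.refl)) (Setoid.refl (car Z (fres f)))
        (pres-graph u f (a f) (b f) fab))
      (pres-graph v f (a f) (b f) fab)
    where
      fab : graph B[ f ] f (a f) (b f)
      fab = f-ab (a f) (λ _ → ≡.refl) (b f) _

  IsCell⇒Epi : {X Y : Structure} {h : Hom X Y} → IsCell h → Epi h
  IsCell⇒Epi (tot f) = Tot-epi f
  IsCell⇒Epi (coprod k cells ι _ κ κ-coprod h comm) Z u v e =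
    ∃!ₘ-unique (κ-coprod Z (λ i → v ∘ₘ κ i)) u v agree (λ i → ≈ₘ-refl {u = v ∘ₘ κ i})
    where
      agree : ∀ i → (u ∘ₘ κ i) ≈ₘ (v ∘ₘ κ i)
      agree i =
        agreement-across-square (k i) (ι i) h (κ i) (IsCell⇒Epi (cells i)) (comm i) u v e
  IsCell⇒Epi (pushout k cell m h m' (square , universal)) Z u v e =
    ∃!ₘ-unique (universal Z (v ∘ₘ h) (v ∘ₘ m') (∘ₘ-congˡ v {h ∘ₘ m} {m' ∘ₘ k} square)) u v
      (e , agreement-across-square k m h m' (IsCell⇒Epi cell) square u v e)
      (≈ₘ-refl {u = v ∘ₘ h} , ≈ₘ-refl {u = v ∘ₘ m'})
  IsCell⇒Epi (seqcomp X k cells L c (cocone , universal) h h≈c₀) Z u v e =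
    ∃!ₘ-unique
      (universal Z (λ n → v ∘ₘ c n) (λ n → ∘ₘ-congˡ v {c (suc n) ∘ₘ k n} {c n} (cocone n)))
      u v agree (λ n → ≈ₘ-refl {u = v ∘ₘ c n})
    where
      agree : ∀ n → (u ∘ₘ c n) ≈ₘ (v ∘ₘ c n)
      agree zero = agreement-resp-≈ₘ u v {h} {c 0} h≈c₀ e
      agree (suc n) = agreement-across-square (k n) idₘ (c n) (c (suc n)) (IsCell⇒Epi (cells n))
                        (≈ₘ-sym {u = c (suc n) ∘ₘ k n} {c n} (cocone n)) u v (agree n)

  record ClosedSubset (Y : Structure) : Set₁ where
    field
      Member : ∀ s → ∣ Y ∣ s → Set
      Member-resp : ∀ s {y y'} → Y ⊢ y ≈ y' → Member s y → Member s y'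
      Member-closed : ∀ f ys y → (∀ i → Member (fsort f i) (ys i)) →
                      graph Y f ys y → Member (fres f) y

  open ClosedSubset

  module Doubling {Y : Structure} (C : ClosedSubset Y) where
    private
      module Y s = Setoid (car Y s)

    -- Y ⊔_C Y: the copies (true , y) and (false , y) are identified exactly when y ∈ C.
    _≈ᵈ_ : ∀ {s} → Bool × ∣ Y ∣ s → Bool × ∣ Y ∣ s → Set
    _≈ᵈ_ {s} (σ , y) (σ' , y') = Y ⊢ y ≈ y' × (σ ≡ σ' ⊎ Member C s y)

    ≈ᵈ-sym : ∀ {s} {x y : Bool × ∣ Y ∣ s} → x ≈ᵈ y → y ≈ᵈ x
    ≈ᵈ-sym {s} (e , tags) = Y.sym s e , [ inj₁ ∘ ≡.sym , inj₂ ∘ Member-resp C s e ] tags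

    ≈ᵈ-trans : ∀ {s} {x y z : Bool × ∣ Y ∣ s} → x ≈ᵈ y → y ≈ᵈ z → x ≈ᵈ z
    ≈ᵈ-trans (e , inj₁ p) (e' , inj₁ q) = Y.trans _ e e' , inj₁ (≡.trans p q)
    ≈ᵈ-trans (e , inj₂ i) (e' , _) = Y.trans _ e e' , inj₂ i
    ≈ᵈ-trans {s} (e , inj₁ _) (e' , inj₂ i) =
      Y.trans s e e' , inj₂ (Member-resp C s (Y.sym s e) i)

    carrier : Sort → Setoid 0ℓ 0ℓ
    carrier s = record
      { Carrier = Bool × ∣ Y ∣ s
      ; _≈_ = _≈ᵈ_
      ; isEquivalence = record
        { refl = Y.refl s , inj₁ ≡.refl ; sym = ≈ᵈ-sym ; trans = ≈ᵈ-trans } }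

    tags-agree-or-closed : ∀ f {σ σ' ys y} → (∀ i → σ ≡ σ' ⊎ Member C (fsort f i) (ys i)) →
                           graph Y f ys y → σ ≡ σ' ⊎ Member C (fres f) y
    tags-agree-or-closed f {σ} {σ'} tags gy with σ ≟ σ'
    ... | yes σ≡σ' = inj₁ σ≡σ'
    ... | no σ≢σ' = inj₂ (Member-closed C f _ _ (λ i → [ ⊥-elim ∘ σ≢σ' , id ] (tags i)) gy)

    graph-tagged : ∀ f {σ σ' ys ys' y y'} →
                   (∀ i → (σ , ys i) ≈ᵈ (σ' , ys' i)) →
                   graph Y f ys y → graph Y f ys' y' → (σ , y) ≈ᵈ (σ' , y')
    graph-tagged f ys≈ys' gy gy' =
      graph-functional Y f (graph-resp Y f (proj₁ ∘ ys≈ys') (Y.refl _) gy) gy' ,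
      tags-agree-or-closed f (proj₂ ∘ ys≈ys') gy

    TaggedGraph : (f : Fun) → Tup carrier (farity f) (fsort f) → Bool × ∣ Y ∣ (fres f) → Set
    TaggedGraph f zs z =
      Σ Bool λ σ → Σ (Tup (car Y) (farity f) (fsort f)) λ ys → Σ (∣ Y ∣ (fres f)) λ y →
      graph Y f ys y × (∀ i → zs i ≈ᵈ (σ , ys i)) × z ≈ᵈ (σ , y)

    Doubled : Structure
    Doubled = record
      { car = carrier
      ; rel = λ p zs → rel Y p (λ i → proj₂ (zs i))
      ; rel-resp = λ p e → rel-resp Y p (proj₁ ∘ e)
      ; graph = TaggedGraph
      ; graph-resp = λ f e e' (σ , ys , y , gy , zs≈ , z≈) →
          σ , ys , y , gy , (λ i → ≈ᵈ-trans (≈ᵈ-sym (e i)) (zs≈ i)) , ≈ᵈ-trans (≈ᵈ-sym e') z≈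
      ; graph-functional = λ f (σ , ys , y , gy , zs≈ , z≈) (σ' , ys' , y' , gy' , zs≈' , z≈') →
          ≈ᵈ-trans z≈ (≈ᵈ-trans
            (graph-tagged f (λ i → ≈ᵈ-trans (≈ᵈ-sym (zs≈ i)) (zs≈' i)) gy gy')
            (≈ᵈ-sym z≈')) }

    ι : Bool → Hom Y Doubled
    ι σ = record
      { fun = λ _ y → σ , y
      ; cong = λ _ e → e , inj₁ ≡.refl
      ; pres-rel = λ _ _ r → r
      ; pres-graph = λ f ys y gy →
          σ , ys , y , gy , (λ i → Y.refl _ , inj₁ ≡.refl) , (Y.refl _ , inj₁ ≡.refl) }

  epi⇒closed-full : {X Y : Structure} (g : Hom X Y) → Epi g → (C : ClosedSubset Y) →
                    (∀ s x → Member C s (fun g s x)) → ∀ s y → Member C s y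
  epi⇒closed-full {Y = Y} g epi C image⊆C s y with epi Doubled (ι true) (ι false) agree s y
    where
      open Doubling C
      agree : (ι true ∘ₘ g) ≈ₘ (ι false ∘ₘ g)
      agree s x = Setoid.refl (car Y s) , inj₂ (image⊆C s x)
  ... | _ , inj₁ ()
  ... | _ , inj₂ y∈C = y∈C

  image-closed : {X' Y : Structure} (g' : Hom X' Y) → TotalOver g' → ClosedSubset Y
  image-closed {X'} {Y} g' total = record
    { Member = λ s y → Σ (∣ X' ∣ s) λ x' → Y ⊢ fun g' s x' ≈ y
    ; Member-resp = λ s y≈y' (x' , e) → x' , Setoid.trans (car Y s) e y≈y'
    ; Member-closed = closed }
    where
      closed : ∀ f ys y → (∀ i → Σ (∣ X' ∣ (fsort f i)) λ x' → Y ⊢ fun g' _ x' ≈ ys i) →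
               graph Y f ys y → Σ (∣ X' ∣ (fres f)) λ x' → Y ⊢ fun g' _ x' ≈ y
      closed f ys y preimages gy = lift (total f xs (y , gxs))
        where
          xs : Tup (car X') (farity f) (fsort f)
          xs = proj₁ ∘ preimages
          gxs : graph Y f (λ i → fun g' (fsort f i) (xs i)) y
          gxs = graph-resp Y f (λ i → Setoid.sym (car Y _) (proj₂ (preimages i)))
                  (Setoid.refl (car Y (fres f))) gy
          lift : Σ (∣ X' ∣ (fres f)) (graph X' f xs) →
                 Σ (∣ X' ∣ (fres f)) λ x' → Y ⊢ fun g' _ x' ≈ y
          lift (x' , gx') = x' , graph-functional Y f (pres-graph g' f xs x' gx') gxs

proposition4p26 : (𝔖 : Signature) → let open Alg 𝔖 in
    (∀ {X Y : Structure} (g : Hom X Y) → Mono g ⇔ Injective g) ×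
    (∀ {X X' Y : Structure} (g : Hom X Y) (h : Hom X X') (g' : Hom X' Y) →
      IsRelativeTotalization g h g' → (Epi g ⇔ Surjective g'))
proposition4p26 𝔖 =
  (λ g → mk⇔ (mono⇒injective g) (injective⇒mono g)) ,
  (λ g h g' (g'h≈g , cell , total) → mk⇔
    (λ epi → epi⇒closed-full g epi (image-closed g' total) (λ s x → fun h s x , g'h≈g s x))
    (λ surj → Epi-resp-≈ₘ {g = g' ∘ₘ h} {g} g'h≈g
      (∘ₘ-epi {g = g'} {h} (surjective⇒epi g' surj) (IsCell⇒Epi cell))))
  where
    open Alg 𝔖
    open Properties 𝔖
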